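{- Let $k\ge 2$ be an integer, let $G$ be a graph having a universal vertex, and let $T$ be a $k$-leaf root of $G$. Then $\mathrm{rad}(T)\le k-1$, and in particular $\mathrm{diam}(T)\le 2k-2$.
   Context: A universal vertex is one adjacent to all other vertices. For an integer $k\ge 2$, a $k$-leaf root of a graph $G$ is a tree $T$ whose leaf set is exactly $V(G)$ such that for all distinct $x,y\in V(G)$, $xy\in E(G)$ iff $\mathrm{dist}_T(x,y)\le k$. For a tree $T$, $\mathrm{rad}(T)=\min_{y}\max_{x}\mathrm{dist}_T(x,y)$ and $\mathrm{diam}(T)$ is the maximum distance between two vertices. -}

module Defs where

open import Data.Nat using (ℕ; zero; suc; _+_; _∸_; _*_; _≤_)
open import Data.Fin using (Fin)
open import Data.List using (List; []; _∷_; length)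
open import Data.List.Relation.Unary.Unique.Propositional using (Unique)
open import Data.Product using (Σ; ∃; ∃-syntax; _×_; _,_)
open import Data.Empty using (⊥)
open import Relation.Nullary using (¬_)
open import Relation.Binary.PropositionalEquality using (_≡_; _≢_)
open import Function.Bundles using (_⇔_)
open import Function.Definitions using (Injective)

record Graph (n : ℕ) : Set₁ where
  field
    Adj    : Fin n → Fin n → Set
    sym    : ∀ {x y} → Adj x y → Adj y x
    irrefl : ∀ {x} → ¬ Adj x x
open Graph public

module _ {n : ℕ} (G : Graph n) where

  data Walk : Fin n → Fin n → Set where
    [_]  : (x : Fin n) → Walk x x
    _∷ʷ_ : ∀ {x y z} → Adj G x y → Walk y z → Walk x z

  len : ∀ {x y} → Walk x y → ℕ
  len [ x ] = 0
  len (e ∷ʷ w) = suc (len w)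

  vertices : ∀ {x y} → Walk x y → List (Fin n)
  vertices [ x ] = x ∷ []
  vertices (_∷ʷ_ {x} e w) = x ∷ vertices w

  IsPath : ∀ {x y} → Walk x y → Set
  IsPath w = Unique (vertices w)

  Connected : Set
  Connected = ∀ x y → Walk x y

  HasCycle : Set
  HasCycle = Σ (Fin n) λ x → Σ (Fin n) λ y → Σ (Walk x y) λ w →
               IsPath w × 2 ≤ len w × Adj G y x

  IsTree : Set
  IsTree = Connected × ¬ HasCycle

  -- dist(x,y) ≤ d  (dist = minimum length of a walk from x to y)
  DistLe : Fin n → Fin n → ℕ → Set
  DistLe x y d = Σ (Walk x y) λ w → len w ≤ d

  IsLeaf : Fin n → Set
  IsLeaf v = Σ (Fin n) λ u → Adj G v u × (∀ w → Adj G v w → w ≡ u)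

  RadLe : ℕ → Set
  RadLe r = ∃[ y ] (∀ x → DistLe x y r)

  DiamLe : ℕ → Set
  DiamLe D = ∀ x y → DistLe x y D

  HasUniversalVertex : Set
  HasUniversalVertex = ∃[ u ] (∀ v → v ≢ u → Adj G u v)

record LeafRoot (k : ℕ) {n m : ℕ} (G : Graph n) (T : Graph m) (φ : Fin n → Fin m) : Set where
  field
    tree      : IsTree T
    injective : Injective _≡_ _≡_ φ
    leaves    : ∀ x → IsLeaf T (φ x)
    onto      : ∀ v → IsLeaf T v → ∃[ x ] (φ x ≡ v)
    adj⇔dist  : ∀ x y → x ≢ y → (Adj G x y ⇔ DistLe T (φ x) (φ y) k)

-- Let a be the leaf of T at the universal vertex and p its unique neighbour. For any vertex
-- x ≠ a, grow the path from x to a beyond x until it starts at a leaf ℓ. Every other leaf is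
-- adjacent to a in G, so dist(ℓ, a) ≤ k; paths in a tree are shortest walks, hence the path from
-- x to a has length at most k, and since it enters a through p, dist(x, p) ≤ k − 1. So p is a
-- centre of radius k − 1, and the diameter is at most twice the radius.
module Submission where

open import Defs
open import Data.Nat using (ℕ; zero; suc; _+_; _*_; _∸_; _≤_; _<_; z≤n; s≤s)
open import Data.Nat.Properties
  using (≤-refl; ≤-trans; ≤-reflexive; m≤n⇒m≤1+n; n≤1+n; m≤m+n; 1+n≰n; +-suc; +-comm;
         +-identityʳ; +-mono-≤; ∸-monoˡ-≤; *-distribˡ-∸)
open import Data.Fin using (Fin; zero; suc)
open import Data.Fin.Properties using (_≟_; any?; injective⇒≤)
open import Data.List using (List; []; _∷_; length; lookup)
open import Data.List.Membership.Propositional using (_∈_)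
open import Data.List.Membership.Propositional.Properties using (∈-lookup)
open import Data.List.Relation.Binary.Subset.Propositional using (_⊆_)
open import Data.List.Relation.Unary.All as All using (All)
open import Data.List.Relation.Unary.All.Properties using (¬Any⇒All¬)
open import Data.List.Relation.Unary.Any using (here; there)
open import Data.List.Relation.Unary.AllPairs using ([]; _∷_)
open import Data.List.Relation.Unary.Unique.Propositional using (Unique)
open import Data.List.Relation.Unary.Unique.Propositional.Properties using (Unique[x∷xs]⇒x∉xs)
open import Data.Product using (Σ; ∃-syntax; _×_; _,_; proj₁; proj₂)
open import Data.Sum using (_⊎_; inj₁; inj₂)
open import Data.Empty using (⊥-elim)
open import Function using (_∘_; id)
open import Function.Bundles using (Equivalence)
open import Function.Definitions using (Injective)
open import Relation.Binary.Definitions using (Decidable)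
open import Relation.Binary.PropositionalEquality as ≡ using (_≡_; _≢_; refl; cong; subst)
open import Relation.Nullary using (¬_; yes; no; ¬?)
open import Relation.Nullary.Decidable using (_×-dec_; decidable-stable)

Unique⇒lookup-injective : {A : Set} {xs : List A} → Unique xs → Injective _≡_ _≡_ (lookup xs)
Unique⇒lookup-injective {xs = _ ∷ _} (_ ∷ _) {zero} {zero} _ = refl
Unique⇒lookup-injective {xs = _ ∷ _} (x∉ ∷ _) {zero} {suc j} eq = ⊥-elim (All.lookup x∉ (∈-lookup j) eq)
Unique⇒lookup-injective {xs = _ ∷ _} (x∉ ∷ _) {suc i} {zero} eq = ⊥-elim (All.lookup x∉ (∈-lookup i) (≡.sym eq))
Unique⇒lookup-injective {xs = _ ∷ _} (_ ∷ u) {suc i} {suc j} eq = cong suc (Unique⇒lookup-injective u eq)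

Unique⇒length≤ : {m : ℕ} {xs : List (Fin m)} → Unique xs → length xs ≤ m
Unique⇒length≤ u = injective⇒≤ (Unique⇒lookup-injective u)

module _ {m : ℕ} {T : Graph m} where
  open import Data.List.Membership.DecPropositional (_≟_ {m}) using (_∈?_)

  _++ʷ_ : {x y z : Fin m} → Walk T x y → Walk T y z → Walk T x z
  [ _ ] ++ʷ w = w
  (e ∷ʷ v) ++ʷ w = e ∷ʷ (v ++ʷ w)

  reverse : {x y : Fin m} → Walk T x y → Walk T y x
  reverse [ x ] = [ x ]
  reverse (_∷ʷ_ {x} e w) = reverse w ++ʷ (sym T e ∷ʷ [ x ])

  len-++ʷ : {x y z : Fin m} (v : Walk T x y) (w : Walk T y z) → len T (v ++ʷ w) ≡ len T v + len T w
  len-++ʷ [ _ ] w = refl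
  len-++ʷ (e ∷ʷ v) w = cong suc (len-++ʷ v w)

  len-reverse : {x y : Fin m} (w : Walk T x y) → len T (reverse w) ≡ len T w
  len-reverse [ _ ] = refl
  len-reverse (e ∷ʷ w) = begin
    len T (reverse w ++ʷ (sym T e ∷ʷ [ _ ])) ≡⟨ len-++ʷ (reverse w) _ ⟩
    len T (reverse w) + 1                     ≡⟨ cong (_+ 1) (len-reverse w) ⟩
    len T w + 1                               ≡⟨ +-comm (len T w) 1 ⟩
    suc (len T w)                             ∎
    where open ≡.≡-Reasoning

  length-vertices : {x y : Fin m} (w : Walk T x y) → length (vertices T w) ≡ suc (len T w)
  length-vertices [ _ ] = refl
  length-vertices (e ∷ʷ w) = cong suc (length-vertices w)

  path-len< : {x y : Fin m} (w : Walk T x y) → IsPath T w → len T w < m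
  path-len< w isP = subst (_≤ m) (length-vertices w) (Unique⇒length≤ isP)

  distinct⇒1≤len : {x y : Fin m} (w : Walk T x y) → x ≢ y → 1 ≤ len T w
  distinct⇒1≤len [ _ ] x≢x = ⊥-elim (x≢x refl)
  distinct⇒1≤len (e ∷ʷ w) _ = s≤s z≤n

  start∈ : {x y : Fin m} (w : Walk T x y) → x ∈ vertices T w
  start∈ [ _ ] = here refl
  start∈ (e ∷ʷ w) = here refl

  end∈ : {x y : Fin m} (w : Walk T x y) → y ∈ vertices T w
  end∈ [ _ ] = here refl
  end∈ (e ∷ʷ w) = there (end∈ w)

  ∈-++ʷ : {x y z u : Fin m} (v : Walk T x y) (w : Walk T y z) →
          u ∈ vertices T (v ++ʷ w) → u ∈ vertices T v ⊎ u ∈ vertices T w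
  ∈-++ʷ [ _ ] w u∈ = inj₂ u∈
  ∈-++ʷ (e ∷ʷ v) w (here refl) = inj₁ (here refl)
  ∈-++ʷ (e ∷ʷ v) w (there u∈) with ∈-++ʷ v w u∈
  ... | inj₁ u∈v = inj₁ (there u∈v)
  ... | inj₂ u∈w = inj₂ u∈w

  vertices-reverse : {x y : Fin m} (w : Walk T x y) → vertices T (reverse w) ⊆ vertices T w
  vertices-reverse [ _ ] u∈ = u∈
  vertices-reverse (e ∷ʷ w) u∈ with ∈-++ʷ (reverse w) _ u∈
  ... | inj₁ u∈w = there (vertices-reverse w u∈w)
  ... | inj₂ (here refl) = there (start∈ w)
  ... | inj₂ (there (here refl)) = here refl

  takeʷ : {x y z : Fin m} (w : Walk T x y) → z ∈ vertices T w → Walk T x z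
  takeʷ [ _ ] (here refl) = [ _ ]
  takeʷ (e ∷ʷ w) (here refl) = [ _ ]
  takeʷ (e ∷ʷ w) (there z∈w) = e ∷ʷ takeʷ w z∈w

  vertices-takeʷ : {x y z : Fin m} (w : Walk T x y) (z∈w : z ∈ vertices T w) →
                   vertices T (takeʷ w z∈w) ⊆ vertices T w
  vertices-takeʷ [ _ ] (here refl) u∈ = u∈
  vertices-takeʷ (e ∷ʷ w) (here refl) (here refl) = here refl
  vertices-takeʷ (e ∷ʷ w) (there z∈w) (here refl) = here refl
  vertices-takeʷ (e ∷ʷ w) (there z∈w) (there u∈) = there (vertices-takeʷ w z∈w u∈)

  dropʷ : {x y z : Fin m} (w : Walk T x y) → z ∈ vertices T w → Walk T z y
  dropʷ [ _ ] (here refl) = [ _ ]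
  dropʷ (e ∷ʷ w) (here refl) = e ∷ʷ w
  dropʷ (e ∷ʷ w) (there z∈w) = dropʷ w z∈w

  len-dropʷ : {x y z : Fin m} (w : Walk T x y) (z∈w : z ∈ vertices T w) → len T (dropʷ w z∈w) ≤ len T w
  len-dropʷ [ _ ] (here refl) = z≤n
  len-dropʷ (e ∷ʷ w) (here refl) = ≤-refl
  len-dropʷ (e ∷ʷ w) (there z∈w) = m≤n⇒m≤1+n (len-dropʷ w z∈w)

  vertices-dropʷ : {x y z : Fin m} (w : Walk T x y) (z∈w : z ∈ vertices T w) →
                   vertices T (dropʷ w z∈w) ⊆ vertices T w
  vertices-dropʷ [ _ ] (here refl) = id
  vertices-dropʷ (e ∷ʷ w) (here refl) = id
  vertices-dropʷ (e ∷ʷ w) (there z∈w) = there ∘ vertices-dropʷ w z∈w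

  dropʷ-path : {x y z : Fin m} (w : Walk T x y) (z∈w : z ∈ vertices T w) →
               IsPath T w → IsPath T (dropʷ w z∈w)
  dropʷ-path [ _ ] (here refl) isP = isP
  dropʷ-path (e ∷ʷ w) (here refl) isP = isP
  dropʷ-path (e ∷ʷ w) (there z∈w) (_ ∷ isP) = dropʷ-path w z∈w isP

  record Shortcut {x y : Fin m} (w : Walk T x y) : Set where
    constructor mkShortcut
    field
      path   : Walk T x y
      isPath : IsPath T path
      len≤   : len T path ≤ len T w
      ⊆walk  : vertices T path ⊆ vertices T w

  shortcut : {x y : Fin m} (w : Walk T x y) → Shortcut w
  shortcut [ x ] = mkShortcut [ x ] (All.[] ∷ []) z≤n id
  shortcut (_∷ʷ_ {x} e w) with shortcut w
  ... | mkShortcut P isP P≤w P⊆w with x ∈? vertices T P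
  ... | yes x∈P = mkShortcut (dropʷ P x∈P) (dropʷ-path P x∈P isP)
                    (≤-trans (len-dropʷ P x∈P) (m≤n⇒m≤1+n P≤w)) (there ∘ P⊆w ∘ vertices-dropʷ P x∈P)
  ... | no x∉P = mkShortcut (e ∷ʷ P) (¬Any⇒All¬ _ x∉P ∷ isP) (s≤s P≤w)
                   λ { (here refl) → here refl ; (there u∈P) → there (P⊆w u∈P) }

  DistLe-mono : {x y : Fin m} {d d′ : ℕ} → d ≤ d′ → DistLe T x y d → DistLe T x y d′
  DistLe-mono d≤d′ (w , w≤d) = w , ≤-trans w≤d d≤d′

  DistLe-sym : {x y : Fin m} {d : ℕ} → DistLe T x y d → DistLe T y x d
  DistLe-sym (w , w≤d) = reverse w , ≤-trans (≤-reflexive (len-reverse w)) w≤d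

  DistLe-trans : {x y z : Fin m} {d d′ : ℕ} → DistLe T x y d → DistLe T y z d′ → DistLe T x z (d + d′)
  DistLe-trans (v , v≤d) (w , w≤d′) = v ++ʷ w , ≤-trans (≤-reflexive (len-++ʷ v w)) (+-mono-≤ v≤d w≤d′)

  RadLe⇒DiamLe : {r : ℕ} → RadLe T r → DiamLe T (2 * r)
  RadLe⇒DiamLe {r} (_ , toCentre) x y =
    DistLe-mono (≤-reflexive (cong (r +_) (≡.sym (+-identityʳ r))))
      (DistLe-trans (toCentre x) (DistLe-sym (toCentre y)))

  walk-from-leaf-via-neighbour : {a p x : Fin m} → (∀ v → Adj T a v → v ≡ p) →
                                 (w : Walk T a x) → a ≢ x → DistLe T p x (len T w ∸ 1)
  walk-from-leaf-via-neighbour _ [ _ ] a≢a = ⊥-elim (a≢a refl)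
  walk-from-leaf-via-neighbour only-p (_∷ʷ_ {y = s} e w) _ with only-p s e
  ... | refl = w , ≤-refl

module Acyclic {m : ℕ} {T : Graph m} (acyclic : ¬ HasCycle T) where
  open import Data.List.Membership.DecPropositional (_≟_ {m}) using (_∈?_)

  -- otherwise a path from b to c avoiding a closes the cycle a b … c a
  neighbours-separated : {a b c : Fin m} → Adj T a b → Adj T a c → b ≢ c →
                         (w : Walk T b c) → a ∈ vertices T w
  neighbours-separated {a} ab ac b≢c w with a ∈? vertices T w
  ... | yes a∈w = a∈w
  ... | no a∉w with shortcut w
  ... | mkShortcut R isR _ R⊆w =
    ⊥-elim (acyclic (a , _ , ab ∷ʷ R , ¬Any⇒All¬ _ (a∉w ∘ R⊆w) ∷ isR , s≤s (distinct⇒1≤len R b≢c) , sym T ac))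

  path-len-≤ : {x y : Fin m} (P Q : Walk T x y) → IsPath T P → IsPath T Q → len T P ≤ len T Q
  path-len-≤ [ _ ] _ _ _ = z≤n
  path-len-≤ (e ∷ʷ P) [ _ ] isP _ = ⊥-elim (Unique[x∷xs]⇒x∉xs isP (end∈ P))
  path-len-≤ (_∷ʷ_ {y = b} e P) (_∷ʷ_ {y = c} f Q) isP@(_ ∷ uP) isQ@(_ ∷ uQ) with b ≟ c
  ... | yes refl = s≤s (path-len-≤ P Q uP uQ)
  ... | no b≢c with ∈-++ʷ Q (reverse P) (neighbours-separated f e (b≢c ∘ ≡.sym) (Q ++ʷ reverse P))
  ... | inj₁ x∈Q = ⊥-elim (Unique[x∷xs]⇒x∉xs isQ x∈Q)
  ... | inj₂ x∈P = ⊥-elim (Unique[x∷xs]⇒x∉xs isP (vertices-reverse P x∈P))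

  path-shortest : {x y : Fin m} (P w : Walk T x y) → IsPath T P → len T P ≤ len T w
  path-shortest P w isP with shortcut w
  ... | mkShortcut Q isQ Q≤w _ = ≤-trans (path-len-≤ P Q isP isQ) Q≤w

  neighbour-on-path : {x q y z : Fin m} (e : Adj T x q) (w : Walk T q y) → IsPath T (e ∷ʷ w) →
                      Adj T x z → z ∈ vertices T w → z ≡ q
  neighbour-on-path {q = q} {z = z} e w isP xz z∈w with z ≟ q
  ... | yes z≡q = z≡q
  ... | no z≢q = ⊥-elim (Unique[x∷xs]⇒x∉xs isP
                   (vertices-takeʷ w z∈w (neighbours-separated e xz (z≢q ∘ ≡.sym) (takeʷ w z∈w))))

  prepend-neighbour : {x q y z : Fin m} (e : Adj T x q) (w : Walk T q y) → IsPath T (e ∷ʷ w) →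
                      (xz : Adj T x z) → z ≢ q → IsPath T (sym T xz ∷ʷ (e ∷ʷ w))
  prepend-neighbour e w isP xz z≢q = All.tabulate z∉ ∷ isP
    where
    z∉ : ∀ {v} → v ∈ vertices T (e ∷ʷ w) → _ ≢ v
    z∉ (here refl) refl = irrefl T xz
    z∉ (there v∈w) refl = z≢q (neighbour-on-path e w isP xz v∈w)

module Tree {m : ℕ} {T : Graph m} (tree : IsTree T) where
  open Acyclic (proj₂ tree)

  tree-path : (x y : Fin m) → Σ (Walk T x y) (IsPath T)
  tree-path x y with shortcut (proj₁ tree x y)
  ... | mkShortcut P isP _ _ = P , isP

  edge-path : {x y : Fin m} (e : Adj T x y) → IsPath T (e ∷ʷ [ y ])
  edge-path e = ((λ { refl → irrefl T e }) All.∷ All.[]) ∷ All.[] ∷ []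

  adjacent? : Decidable (Adj T)
  adjacent? x y with tree-path x y
  ... | [ _ ] , _ = no (irrefl T)
  ... | e ∷ʷ [ _ ] , _ = yes e
  ... | P@(_ ∷ʷ (_ ∷ʷ _)) , isP = no λ e → 1+n≰n (≤-trans (s≤s (s≤s z≤n)) (path-len-≤ P (e ∷ʷ [ y ]) isP (edge-path e)))

  LeafPathTo : Fin m → ℕ → Set
  LeafPathTo t n = ∃[ ℓ ] IsLeaf T ℓ × Σ (Walk T ℓ t) λ w → IsPath T w × n ≤ len T w

  -- fuel bounds how often the path can still grow, since a path has fewer than m edges
  private
    grow : {t : Fin m} (fuel : ℕ) {x q : Fin m} (e : Adj T x q) (w : Walk T q t) →
           IsPath T (e ∷ʷ w) → m ≤ fuel + len T (e ∷ʷ w) → LeafPathTo t (len T (e ∷ʷ w))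
    grow zero e w isP m≤ = ⊥-elim (1+n≰n (≤-trans (path-len< (e ∷ʷ w) isP) m≤))
    grow (suc fuel) {x} {q} e w isP m≤ with any? (λ z → adjacent? x z ×-dec ¬? (z ≟ q))
    ... | no ¬other = x , (q , e , only-q) , e ∷ʷ w , isP , ≤-refl
      where
      only-q : ∀ z → Adj T x z → z ≡ q
      only-q z xz = decidable-stable (z ≟ q) (λ z≢q → ¬other (z , xz , z≢q))
    ... | yes (z , xz , z≢q)
      with grow fuel (sym T xz) (e ∷ʷ w) (prepend-neighbour e w isP xz z≢q)
                (≤-trans m≤ (≤-reflexive (≡.sym (+-suc fuel (len T (e ∷ʷ w))))))
    ... | ℓ , leaf , w′ , isW′ , ≤w′ = ℓ , leaf , w′ , isW′ , ≤-trans (n≤1+n _) ≤w′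

  extend-to-leaf : {x t : Fin m} (w : Walk T x t) → IsPath T w → x ≢ t → LeafPathTo t (len T w)
  extend-to-leaf [ _ ] _ x≢x = ⊥-elim (x≢x refl)
  extend-to-leaf (e ∷ʷ w) isP _ = grow m e w isP (m≤m+n m _)

  leaves-near⇒RadLe : {k : ℕ} {a : Fin m} → 2 ≤ k → IsLeaf T a →
                      (∀ ℓ → IsLeaf T ℓ → DistLe T a ℓ k) → RadLe T (k ∸ 1)
  leaves-near⇒RadLe {k} {a} 2≤k (p , ap , only-p) near = p , toCentre
    where
    toCentre : ∀ x → DistLe T x p (k ∸ 1)
    toCentre x with x ≟ a
    ... | yes refl = ap ∷ʷ [ p ] , ∸-monoˡ-≤ 1 2≤k
    ... | no x≢a with tree-path x a
    ... | P , isP with extend-to-leaf P isP x≢a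
    ... | ℓ , leaf , W , isW , P≤W with DistLe-sym (near ℓ leaf)
    ... | D , D≤k = DistLe-sym (DistLe-mono (∸-monoˡ-≤ 1 P≤k)
                      (walk-from-leaf-via-neighbour only-p (reverse P) (x≢a ∘ ≡.sym)))
      where
      P≤k : len T (reverse P) ≤ k
      P≤k = ≤-trans (≤-reflexive (len-reverse P)) (≤-trans P≤W (≤-trans (path-shortest W D isW) D≤k))

corollary1 : (k : ℕ) → 2 ≤ k → {n m : ℕ} (G : Graph n) (T : Graph m) (φ : Fin n → Fin m) →
    HasUniversalVertex G → LeafRoot k G T φ →
    RadLe T (k ∸ 1) × DiamLe T (2 * k ∸ 2)
corollary1 k 2≤k G T φ (u , universal) root = rad , subst (DiamLe T) (*-distribˡ-∸ 2 k 1) (RadLe⇒DiamLe rad)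
  where
  open LeafRoot root
  near : ∀ ℓ → IsLeaf T ℓ → DistLe T (φ u) ℓ k
  near ℓ leaf with onto ℓ leaf
  ... | y , refl with y ≟ u
  ... | yes refl = [ φ u ] , z≤n
  ... | no y≢u = Equivalence.to (adj⇔dist u y (y≢u ∘ ≡.sym)) (universal y y≢u)
  rad : RadLe T (k ∸ 1)
  rad = Tree.leaves-near⇒RadLe tree 2≤k (leaves u) near
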